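{- Let $Act$ be a set with a partition $\{Act^r,Act^l,Act^{bi}\}$. The order $\sqsubseteq^{cc}$ on the functor $\mathcal{P}^{Act}$, defined by $\alpha\sqsubseteq^{cc}_X\alpha'$ iff $\alpha(a)\subseteq\alpha'(a)$ for all $a\in Act^r\cup Act^{bi}$ and $\alpha(a)\supseteq\alpha'(a)$ for all $a\in Act^l\cup Act^{bi}$, is stable.
   Context: $\mathcal{P}$ is the covariant powerset functor and $F=\mathcal{P}^{Act}$, $X\mapsto(\mathcal{P}X)^{Act}$, $Ff(\alpha)(a)=f(\alpha(a))$. For $R\subseteq X_1\times X_2$ with projections $r_1,r_2$: $\mathrm{Rel}(F)(R)=\{(u,v)\mid\exists w\in F(R).\,Fr_1(w)=u,\ Fr_2(w)=v\}$ and $\mathrm{Rel}_{\sqsubseteq}(F)(R)=\{(u,v)\mid\exists w\in F(R).\,u\sqsubseteq_{X_1}Fr_1(w)\wedge Fr_2(w)\sqsubseteq_{X_2}v\}$. An order $\sqsubseteq$ on $F$ is stable if for all $f:X\to Z$, $g:Y\to W$, $R\subseteq Z\times W$: $\mathrm{Rel}_{\sqsubseteq}(F)((f\times g)^{ -1}(R))=(Ff\times Fg)^{ -1}(\mathrm{Rel}_{\sqsubseteq}(F)(R))$. -}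

module Defs where

open import Level using (Level; 0ℓ) renaming (suc to lsuc)
open import Data.Product using (Σ; Σ-syntax; ∃; ∃-syntax; _×_; _,_; proj₁; proj₂)
open import Data.Sum using (_⊎_)
open import Relation.Binary.PropositionalEquality using (_≡_)

𝒫 : Set → Set₁
𝒫 X = X → Set

_⊆_ : {X : Set} → 𝒫 X → 𝒫 X → Set
S ⊆ T = ∀ x → S x → T x

𝒫₁ : {X Y : Set} → (X → Y) → 𝒫 X → 𝒫 Y
𝒫₁ {X} f S y = Σ[ x ∈ X ] (S x × f x ≡ y)

-- A partition of Act into Act^r, Act^l, Act^bi, given by a classifying map.
data Kind : Set where
  r l bi : Kind

module _ (Act : Set) where

  F₀ : Set → Set₁
  F₀ X = Act → 𝒫 X

  F₁ : {X Y : Set} → (X → Y) → F₀ X → F₀ Y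
  F₁ f α a = 𝒫₁ f (α a)

  OrderOnF : Set₁
  OrderOnF = (X : Set) → F₀ X → F₀ X → Set

  BinRel : Set → Set → Set₁
  BinRel Z W = Z → W → Set

  Carrier : {Z W : Set} → BinRel Z W → Set
  Carrier {Z} {W} R = Σ[ p ∈ Z × W ] R (proj₁ p) (proj₂ p)

  π₁ : {Z W : Set} (R : BinRel Z W) → Carrier R → Z
  π₁ R ((z , _) , _) = z

  π₂ : {Z W : Set} (R : BinRel Z W) → Carrier R → W
  π₂ R ((_ , w) , _) = w

  RelF : {X₁ X₂ : Set} → BinRel X₁ X₂ → F₀ X₁ → F₀ X₂ → Set₁
  RelF R u v = Σ[ w ∈ F₀ (Carrier R) ] (F₁ (π₁ R) w ≡ u × F₁ (π₂ R) w ≡ v)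

  RelF⊑ : (⊑ : OrderOnF) {X₁ X₂ : Set} → BinRel X₁ X₂ → F₀ X₁ → F₀ X₂ → Set₁
  RelF⊑ ⊑ {X₁} {X₂} R u v =
    Σ[ w ∈ F₀ (Carrier R) ] (⊑ X₁ u (F₁ (π₁ R) w) × ⊑ X₂ (F₁ (π₂ R) w) v)

  _⁻¹[_,_] : {X Y Z W : Set} → BinRel Z W → (X → Z) → (Y → W) → BinRel X Y
  (R ⁻¹[ f , g ]) x y = R (f x) (g y)

  Stable : OrderOnF → Set₁
  Stable ⊑ = ∀ {X Y Z W : Set} (f : X → Z) (g : Y → W) (R : BinRel Z W)
    (u : F₀ X) (v : F₀ Y) →
    (RelF⊑ ⊑ (R ⁻¹[ f , g ]) u v → RelF⊑ ⊑ R (F₁ f u) (F₁ g v))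
    × (RelF⊑ ⊑ R (F₁ f u) (F₁ g v) → RelF⊑ ⊑ (R ⁻¹[ f , g ]) u v)

  module _ (kind : Act → Kind) where

    InRBi : Act → Set
    InRBi a = kind a ≡ r ⊎ kind a ≡ bi

    InLBi : Act → Set
    InLBi a = kind a ≡ l ⊎ kind a ≡ bi

    ⊑cc : OrderOnF
    ⊑cc X α α' = ∀ a → (InRBi a → α a ⊆ α' a) × (InLBi a → α' a ⊆ α a)

{-# OPTIONS --safe #-}
module Submission where

-- ⊑cc is a preorder that every F f preserves, and F is functorial up to mutual
-- inclusion; so a witness w for the preimage relation R ⁻¹[ f , g ] is pushed
-- forward along (x , y , ρ) ↦ (f x , g y , ρ) to a witness for R.  Conversely,
-- given a witness for R, take all R-related pairs from u a × v a: half of the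
-- required inclusions hold trivially, and the others (u a ⊆ π₁[w a] for a in
-- Act^r ∪ Act^bi, v a ⊆ π₂[w a] for a in Act^l ∪ Act^bi) follow by chasing an
-- element through the given witness to an R-related partner.

open import Defs
open import Function using (_∘_)
open import Data.Product using (_×_; _,_; proj₁; proj₂)
open import Relation.Binary.PropositionalEquality using (refl)

⊆-trans : {X : Set} {S T U : 𝒫 X} → S ⊆ T → T ⊆ U → S ⊆ U
⊆-trans S⊆T T⊆U x = T⊆U x ∘ S⊆T x

module _ {X Y : Set} where

  𝒫₁-mono : (f : X → Y) {S T : 𝒫 X} → S ⊆ T → 𝒫₁ f S ⊆ 𝒫₁ f T
  𝒫₁-mono f S⊆T y (x , Sx , fx≡y) = x , S⊆T x Sx , fx≡y

  module _ {Z : Set} (g : Y → Z) (f : X → Y) (S : 𝒫 X) where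

    𝒫₁-∘-⊆ : 𝒫₁ (g ∘ f) S ⊆ 𝒫₁ g (𝒫₁ f S)
    𝒫₁-∘-⊆ z (x , Sx , refl) = f x , (x , Sx , refl) , refl

    𝒫₁-∘-⊇ : 𝒫₁ g (𝒫₁ f S) ⊆ 𝒫₁ (g ∘ f) S
    𝒫₁-∘-⊇ z (y , (x , Sx , refl) , refl) = x , Sx , refl

module _ (Act : Set) where

  module _ {X Y Z W : Set} (f : X → Z) (g : Y → W) (R : BinRel Act Z W) where

    private
      R⁻¹ : BinRel Act X Y
      R⁻¹ = _⁻¹[_,_] Act R f g

    pushPair : Carrier Act R⁻¹ → Carrier Act R
    pushPair ((x , y) , ρ) = (f x , g y) , ρ

    _⊠_ : 𝒫 X → 𝒫 Y → 𝒫 (Carrier Act R⁻¹)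
    (S ⊠ T) ((x , y) , _) = S x × T y

    module _ {S : 𝒫 X} {T : 𝒫 Y} where

      π₁-⊠ : 𝒫₁ (π₁ Act R⁻¹) (S ⊠ T) ⊆ S
      π₁-⊠ x (_ , (Sx , _) , refl) = Sx

      π₂-⊠ : 𝒫₁ (π₂ Act R⁻¹) (S ⊠ T) ⊆ T
      π₂-⊠ y (_ , (_ , Ty) , refl) = Ty

      module _ {V : 𝒫 (Carrier Act R)} where

        ⊆-π₁-⊠ : 𝒫₁ f S ⊆ 𝒫₁ (π₁ Act R) V → 𝒫₁ (π₂ Act R) V ⊆ 𝒫₁ g T →
                 S ⊆ 𝒫₁ (π₁ Act R⁻¹) (S ⊠ T)
        ⊆-π₁-⊠ fS⊆ ⊆gT x Sx with fS⊆ (f x) (x , Sx , refl)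
        ... | ((_ , z) , ρ) , Vc , refl with ⊆gT z (((f x , z) , ρ) , Vc , refl)
        ... | y , Ty , refl = ((x , y) , ρ) , (Sx , Ty) , refl

        ⊆-π₂-⊠ : 𝒫₁ g T ⊆ 𝒫₁ (π₂ Act R) V → 𝒫₁ (π₁ Act R) V ⊆ 𝒫₁ f S →
                 T ⊆ 𝒫₁ (π₂ Act R⁻¹) (S ⊠ T)
        ⊆-π₂-⊠ gT⊆ ⊆fS y Ty with gT⊆ (g y) (y , Ty , refl)
        ... | ((z , _) , ρ) , Vc , refl with ⊆fS z (((z , g y) , ρ) , Vc , refl)
        ... | x , Sx , refl = ((x , y) , ρ) , (Sx , Ty) , refl

  module _ (kind : Act → Kind) where

    private
      _⊑_ : {X : Set} → F₀ Act X → F₀ Act X → Set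
      _⊑_ {X} = ⊑cc Act kind X

    ⊑cc-trans : {X : Set} {α β γ : F₀ Act X} → α ⊑ β → β ⊑ γ → α ⊑ γ
    ⊑cc-trans α⊑β β⊑γ a =
      (λ k → ⊆-trans (proj₁ (α⊑β a) k) (proj₁ (β⊑γ a) k)) ,
      (λ k → ⊆-trans (proj₂ (β⊑γ a) k) (proj₂ (α⊑β a) k))

    ⊑cc-F₁ : {X Y : Set} (f : X → Y) {α β : F₀ Act X} → α ⊑ β → F₁ Act f α ⊑ F₁ Act f β
    ⊑cc-F₁ f α⊑β a =
      (λ k → 𝒫₁-mono f (proj₁ (α⊑β a) k)) , (λ k → 𝒫₁-mono f (proj₂ (α⊑β a) k))

    module _ {X Y Z : Set} (g : Y → Z) (f : X → Y) (α : F₀ Act X) where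

      F₁-∘-⊑ : F₁ Act (g ∘ f) α ⊑ F₁ Act g (F₁ Act f α)
      F₁-∘-⊑ a = (λ _ → 𝒫₁-∘-⊆ g f (α a)) , (λ _ → 𝒫₁-∘-⊇ g f (α a))

      F₁-∘-⊒ : F₁ Act g (F₁ Act f α) ⊑ F₁ Act (g ∘ f) α
      F₁-∘-⊒ a = (λ _ → 𝒫₁-∘-⊇ g f (α a)) , (λ _ → 𝒫₁-∘-⊆ g f (α a))

    module _ {X Y Z W : Set} (f : X → Z) (g : Y → W) (R : BinRel Act Z W)
             {u : F₀ Act X} {v : F₀ Act Y} where

      private
        R⁻¹ : BinRel Act X Y
        R⁻¹ = _⁻¹[_,_] Act R f g

      RelF⊑cc-preimage⇒ : RelF⊑ Act (⊑cc Act kind) R⁻¹ u v →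
                          RelF⊑ Act (⊑cc Act kind) R (F₁ Act f u) (F₁ Act g v)
      RelF⊑cc-preimage⇒ (w , u⊑ , ⊑v) =
        F₁ Act (pushPair f g R) w ,
        ⊑cc-trans (⊑cc-F₁ f u⊑)
          (⊑cc-trans (F₁-∘-⊒ f (π₁ Act R⁻¹) w) (F₁-∘-⊑ (π₁ Act R) (pushPair f g R) w)) ,
        ⊑cc-trans (F₁-∘-⊒ (π₂ Act R) (pushPair f g R) w)
          (⊑cc-trans (F₁-∘-⊑ g (π₂ Act R⁻¹) w) (⊑cc-F₁ g ⊑v))

      RelF⊑cc-preimage⇐ : RelF⊑ Act (⊑cc Act kind) R (F₁ Act f u) (F₁ Act g v) →
                          RelF⊑ Act (⊑cc Act kind) R⁻¹ u v
      RelF⊑cc-preimage⇐ (w , fu⊑ , ⊑gv) =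
        (λ a → _⊠_ f g R (u a) (v a)) ,
        (λ a → (λ k → ⊆-π₁-⊠ f g R (proj₁ (fu⊑ a) k) (proj₁ (⊑gv a) k)) ,
               (λ _ → π₁-⊠ f g R)) ,
        (λ a → (λ _ → π₂-⊠ f g R) ,
               (λ k → ⊆-π₂-⊠ f g R (proj₂ (⊑gv a) k) (proj₂ (fu⊑ a) k)))

lemma3 : (Act : Set) (kind : Act → Kind) → Stable Act (⊑cc Act kind)
lemma3 Act kind f g R u v =
  RelF⊑cc-preimage⇒ Act kind f g R , RelF⊑cc-preimage⇐ Act kind f g R
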